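{- Let $\Phi$ be the root system of type $E_6$, $E_7$ or $E_8$. Then there exists a subset $H\subset\Phi$ containing exactly one vector from each antipodal pair $\{\alpha,-\alpha\}$ of $\Phi$ with $\sum_{\alpha\in H}\alpha=\mathbf{0}$ when $\Phi$ is of type $E_6$ or $E_8$, and no such subset exists when $\Phi$ is of type $E_7$.
   Context: Concretely (with $\varepsilon_i$ the standard basis vectors): $E_8\subset\mathbb{R}^8$ consists of the 112 vectors $\pm\varepsilon_i\pm\varepsilon_j$ ($1\le i<j\le 8$) together with the 128 vectors $\frac12\sum_{i=1}^8 c_i\varepsilon_i$ with $c_i\in\{\pm1\}$ and $\prod_i c_i=1$. $E_7$ can be realized in $\mathbb{R}^8$ as the vectors $\varepsilon_i-\varepsilon_j$ ($1\le i\ne j\le 8$) together with the vectors $\frac12\sum_{i=1}^8 c_i\varepsilon_i$ with $c_i\in\{\pm1\}$ and $\sum_i c_i=0$ (126 roots). $E_6$ can be realized in $\mathbb{R}^6$ as the vectors $\pm\varepsilon_i\pm\varepsilon_j$ ($1\le i<j\le 5$) together with the vectors $\frac{\sqrt3}{2}c_6\varepsilon_6+\frac12\sum_{i=1}^5 c_i\varepsilon_i$ with $c_i\in\{\pm1\}$ and $\prod_{i=1}^6 c_i=-1$ (72 roots). A "half" of an antipodal set means a subset containing exactly one vector from each antipodal pair. -}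

module Defs where

open import Data.Nat using (ℕ; zero; suc; _<ᵇ_)
open import Data.Integer using (ℤ; +_; -_; _+_; _*_)
open import Data.Fin using (Fin; toℕ; inject₁)
open import Data.Fin.Properties using () renaming (_≟_ to _≟ᶠ_)
open import Data.Bool using (if_then_else_)
open import Data.List using (List; []; _∷_; _++_; concatMap; allFin)
import Data.Vec as V
open V using (Vec)
open import Data.List.Membership.Propositional using (_∈_)
open import Data.List.Relation.Unary.Unique.Propositional using (Unique)
open import Data.Product using (_×_)
open import Data.Sum using (_⊎_)
open import Relation.Nullary using (¬_; does)
open import Relation.Binary.PropositionalEquality using (_≡_)

-- Convention: every root is stored as an integer vector, namely TWICE the
-- actual root (so that the half-integral coordinates become integers).
-- For E6 the 6th stored coordinate is the coefficient of √3 in twice the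
-- actual 6th coordinate (twice (√3/2)c₆ = √3·c₆, stored as c₆).
-- These encodings are injective ℚ-linear maps, so a sum is 0 iff its
-- encoding is 0.

_⊕_ : ∀ {n} → Vec ℤ n → Vec ℤ n → Vec ℤ n
_⊕_ = V.zipWith _+_

neg : ∀ {n} → Vec ℤ n → Vec ℤ n
neg = V.map -_

𝟎 : ∀ {n} → Vec ℤ n
𝟎 = V.replicate _ (+ 0)

vsum : ∀ {n} → List (Vec ℤ n) → Vec ℤ n
vsum [] = 𝟎
vsum (v ∷ vs) = v ⊕ vsum vs

pm : List ℤ
pm = + 1 ∷ - (+ 1) ∷ []

signs : (n : ℕ) → List (Vec ℤ n)
signs zero = V.[] ∷ []
signs (suc n) = concatMap (λ v → concatMap (λ c → (c V.∷ v) ∷ []) pm) (signs n)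

prodV : ∀ {n} → Vec ℤ n → ℤ
prodV = V.foldr _ _*_ (+ 1)

sumV : ∀ {n} → Vec ℤ n → ℤ
sumV = V.foldr _ _+_ (+ 0)

twoVec : ∀ {n} → Fin n → ℤ → Fin n → ℤ → Vec ℤ n
twoVec i s j t = V.tabulate λ k →
  (if does (k ≟ᶠ i) then s + s else + 0) + (if does (k ≟ᶠ j) then t + t else + 0)

filterL : ∀ {A : Set} → (A → Data.Bool.Bool) → List A → List A
filterL p [] = []
filterL p (x ∷ xs) = if p x then x ∷ filterL p xs else filterL p xs

open import Data.Integer using (_≟_)

E8 : List (Vec ℤ 8)
E8 = concatMap (λ i → concatMap (λ j →
        if toℕ i <ᵇ toℕ j
        then concatMap (λ s → concatMap (λ t → twoVec i s j t ∷ []) pm) pm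
        else []) (allFin 8)) (allFin 8)
     ++ filterL (λ c → does (prodV c ≟ + 1)) (signs 8)

E7 : List (Vec ℤ 8)
E7 = concatMap (λ i → concatMap (λ j →
        if does (i ≟ᶠ j) then [] else twoVec i (+ 1) j (- (+ 1)) ∷ [])
        (allFin 8)) (allFin 8)
     ++ filterL (λ c → does (sumV c ≟ + 0)) (signs 8)

E6 : List (Vec ℤ 6)
E6 = concatMap (λ i → concatMap (λ j →
        if toℕ i <ᵇ toℕ j
        then concatMap (λ s → concatMap (λ t →
               twoVec (inject₁ i) s (inject₁ j) t ∷ []) pm) pm
        else []) (allFin 5)) (allFin 5)
     ++ filterL (λ c → does (prodV c ≟ - (+ 1))) (signs 6)

IsHalf : ∀ {n} → List (Vec ℤ n) → List (Vec ℤ n) → Set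
IsHalf {n} Φ H =
  Unique H ×
  (∀ (α : Vec ℤ n) → α ∈ H → α ∈ Φ) ×
  (∀ (α : Vec ℤ n) → α ∈ Φ → (α ∈ H ⊎ neg α ∈ H) × ¬ (α ∈ H × neg α ∈ H))

HasZeroSumHalf : ∀ {n} → List (Vec ℤ n) → Set
HasZeroSumHalf {n} Φ = Data.Product.∃ λ (H : List (Vec ℤ n)) → IsHalf Φ H × vsum H ≡ 𝟎

{-# OPTIONS --safe #-}
-- For E6 and E8 a zero-sum half is exhibited and checked by computation.
-- For E7 let ℓ be the inner product with ε₁ + ε₂ (in the doubled encoding).
-- A half H of an antipodal set Φ satisfies H ⊎ −H = Φ, so for Φ = E7 we get
-- Σ_H ∣ℓ∣ = ½ Σ_Φ ∣ℓ∣ = 54.  On E7, ℓ takes only the values 0 and ±2, so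
-- 4 ∣ ℓ + ∣ℓ∣ there; hence ℓ (Σ_H α) ≡ −54 ≢ 0 (mod 4) and Σ_H α ≠ 0.
module Submission where

open import Defs
open import Data.Nat as ℕ using (ℕ; _*_)
import Data.Nat.Properties as ℕ
open import Data.Nat.ListAction using (sum)
open import Data.Nat.ListAction.Properties using (sum-++; sum-↭)
open import Data.Integer as ℤ using (ℤ; +_; -[1+_]; -_; ∣_∣) renaming (_+_ to _+ℤ_)
import Data.Integer.Properties as ℤ
open import Data.Integer.Divisibility.Signed using (_∣_; _∣?_; divides; ∣m∣n⇒∣m+n)
open import Algebra.Properties.CommutativeSemigroup ℤ.+-commutativeSemigroup using (interchange)
open import Data.Vec using (Vec; []; _∷_)
import Data.Vec.Properties as Vec
open import Data.List as List using (List; _++_; map)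
open import Data.List.Properties using (map-++; map-∘; map-cong)
open import Data.List.Relation.Unary.All as All using (All; all?)
open import Data.List.Relation.Unary.All.Properties using (anti-mono)
open import Data.List.Membership.Propositional using (_∈_)
open import Data.List.Membership.Propositional.Properties using (∈-map⁺; ∈-map⁻; ∈-++⁺ˡ; ∈-++⁺ʳ; ∈-++⁻)
open import Data.List.Membership.Propositional.Properties.WithK using (unique∧set⇒bag)
import Data.List.Membership.DecPropositional as DecMembership
open import Data.List.Relation.Binary.BagAndSetEquality using (∼bag⇒↭)
open import Data.List.Relation.Binary.Permutation.Propositional using (_↭_)
import Data.List.Relation.Binary.Permutation.Propositional.Properties as ↭
open import Data.List.Relation.Unary.Unique.Propositional using (Unique)
import Data.List.Relation.Unary.Unique.Propositional.Properties as Unique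
open import Data.List.Relation.Unary.Unique.DecPropositional using (unique?)
open import Data.Product using (_×_; _,_; proj₁; proj₂)
open import Data.Sum using (inj₁; inj₂)
open import Function using (_∘_; mk⇔)
open import Relation.Nullary using (¬_; Dec)
open import Relation.Nullary.Decidable using (True; toWitness; toWitnessFalse; map′; _×-dec_; _⊎-dec_; ¬?)
open import Relation.Unary using (Decidable)
open import Relation.Binary.Definitions using (DecidableEquality)
open import Relation.Binary.PropositionalEquality using (_≡_; refl; sym; trans; cong; cong₂; subst; subst₂; module ≡-Reasoning)

neg-involutive : ∀ {n} (v : Vec ℤ n) → neg (neg v) ≡ v
neg-involutive []      = refl
neg-involutive (a ∷ v) = cong₂ _∷_ (ℤ.neg-involutive a) (neg-involutive v)

neg-injective : ∀ {n} {u v : Vec ℤ n} → neg u ≡ neg v → u ≡ v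
neg-injective {u = u} {v} eq =
  trans (sym (neg-involutive u)) (trans (cong neg eq) (neg-involutive v))

NegClosed : ∀ {n} → List (Vec ℤ n) → Set
NegClosed Φ = ∀ α → α ∈ Φ → neg α ∈ Φ

module _ {n} {Φ H : List (Vec ℤ n)} where

  half++neg-half↭ : Unique Φ → NegClosed Φ → IsHalf Φ H → H ++ map neg H ↭ Φ
  half++neg-half↭ Φ-unique Φ-closed (H-unique , H⊆Φ , H-half) =
    ∼bag⇒↭ (unique∧set⇒bag both-unique Φ-unique (mk⇔ to from))
    where
    both-unique : Unique (H ++ map neg H)
    both-unique = Unique.++⁺ H-unique (Unique.map⁺ neg-injective H-unique) disjoint
      where
      disjoint : ∀ {v} → ¬ (v ∈ H × v ∈ map neg H)
      disjoint (v∈H , v∈-H) with ∈-map⁻ neg v∈-H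
      ... | β , β∈H , refl = proj₂ (H-half β (H⊆Φ β β∈H)) (β∈H , v∈H)

    to : ∀ {v} → v ∈ H ++ map neg H → v ∈ Φ
    to {v} v∈ with ∈-++⁻ H v∈
    ... | inj₁ v∈H = H⊆Φ v v∈H
    ... | inj₂ v∈-H with ∈-map⁻ neg v∈-H
    ...   | β , β∈H , refl = Φ-closed β (H⊆Φ β β∈H)

    from : ∀ {v} → v ∈ Φ → v ∈ H ++ map neg H
    from {v} v∈Φ with proj₁ (H-half v v∈Φ)
    ... | inj₁ v∈H  = ∈-++⁺ˡ v∈H
    ... | inj₂ -v∈H =
      ∈-++⁺ʳ H (subst (_∈ map neg H) (neg-involutive v) (∈-map⁺ neg -v∈H))

  sum-half : (g : Vec ℤ n → ℕ) → (∀ α → g (neg α) ≡ g α) →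
             Unique Φ → NegClosed Φ → IsHalf Φ H →
             2 * sum (map g H) ≡ sum (map g Φ)
  sum-half g g-even Φ-unique Φ-closed H-half = begin
    2 * sum (map g H)                                ≡⟨ cong (sum (map g H) ℕ.+_) (ℕ.+-identityʳ _) ⟩
    sum (map g H) ℕ.+ sum (map g H)                  ≡⟨ cong (sum (map g H) ℕ.+_) (cong sum (map-cong g-even H)) ⟨
    sum (map g H) ℕ.+ sum (map (g ∘ neg) H)          ≡⟨ cong (sum (map g H) ℕ.+_) (cong sum (map-∘ H)) ⟩
    sum (map g H) ℕ.+ sum (map g (map neg H))        ≡⟨ sum-++ (map g H) _ ⟨
    sum (map g H ++ map g (map neg H))               ≡⟨ cong sum (map-++ g H (map neg H)) ⟨
    sum (map g (H ++ map neg H))                     ≡⟨ sum-↭ (↭.map⁺ g (half++neg-half↭ Φ-unique Φ-closed H-half)) ⟩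
    sum (map g Φ)                                    ∎
    where open ≡-Reasoning

module _ {n : ℕ} where
  _≟ᵥ_ : DecidableEquality (Vec ℤ n)
  _≟ᵥ_ = Vec.≡-dec ℤ._≟_

  open DecMembership _≟ᵥ_ using (_∈?_)

  ∀∈? : {P : Vec ℤ n → Set} → Decidable P → (xs : List (Vec ℤ n)) → Dec (∀ x → x ∈ xs → P x)
  ∀∈? P? xs = map′ (λ ps x → All.lookup ps) (λ f → All.tabulate (f _)) (all? P? xs)

  isHalf? : (Φ H : List (Vec ℤ n)) → Dec (IsHalf Φ H)
  isHalf? Φ H =
    unique? _≟ᵥ_ H ×-dec ∀∈? (_∈? Φ) H ×-dec
    ∀∈? (λ α → ((α ∈? H) ⊎-dec (neg α ∈? H)) ×-dec ¬? ((α ∈? H) ×-dec (neg α ∈? H))) Φ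

  negClosed? : (Φ : List (Vec ℤ n)) → Dec (NegClosed Φ)
  negClosed? Φ = ∀∈? (λ α → neg α ∈? Φ) Φ

zeroSumHalf : ∀ {n} (Φ H : List (Vec ℤ n)) → {True (isHalf? Φ H)} → vsum H ≡ 𝟎 → HasZeroSumHalf Φ
zeroSumHalf Φ H {H-half} H-sum = H , toWitness H-half , H-sum

ℓ : ∀ {n} → Vec ℤ (2 ℕ.+ n) → ℤ
ℓ (a ∷ b ∷ _) = a +ℤ b

ℓ-⊕ : ∀ {n} (u v : Vec ℤ (2 ℕ.+ n)) → ℓ (u ⊕ v) ≡ ℓ u +ℤ ℓ v
ℓ-⊕ (a ∷ b ∷ _) (c ∷ d ∷ _) = interchange a c b d

ℓ-neg : ∀ {n} (v : Vec ℤ (2 ℕ.+ n)) → ℓ (neg v) ≡ - ℓ v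
ℓ-neg (a ∷ b ∷ _) = sym (ℤ.neg-distrib-+ a b)

∣ℓ∣ : ∀ {n} → Vec ℤ (2 ℕ.+ n) → ℕ
∣ℓ∣ v = ∣ ℓ v ∣

∣ℓ∣-neg : ∀ {n} (v : Vec ℤ (2 ℕ.+ n)) → ∣ℓ∣ (neg v) ≡ ∣ℓ∣ v
∣ℓ∣-neg v = trans (cong ∣_∣ (ℓ-neg v)) (ℤ.∣-i∣≡∣i∣ (ℓ v))

∣ℓ[vsum]+sum∣ℓ∣ : ∀ {n m} (H : List (Vec ℤ (2 ℕ.+ n))) →
  All (λ α → m ∣ ℓ α +ℤ + ∣ℓ∣ α) H → m ∣ ℓ (vsum H) +ℤ + sum (map ∣ℓ∣ H)
∣ℓ[vsum]+sum∣ℓ∣ List.[] All.[] = divides (+ 0) refl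
∣ℓ[vsum]+sum∣ℓ∣ (α List.∷ H) (m∣α All.∷ m∣H) =
  subst (_ ∣_) (sym regroup) (∣m∣n⇒∣m+n m∣α (∣ℓ[vsum]+sum∣ℓ∣ H m∣H))
  where
  s = sum (map ∣ℓ∣ H)
  regroup : ℓ (α ⊕ vsum H) +ℤ + (∣ℓ∣ α ℕ.+ s) ≡ (ℓ α +ℤ + ∣ℓ∣ α) +ℤ (ℓ (vsum H) +ℤ + s)
  regroup = begin
    ℓ (α ⊕ vsum H) +ℤ + (∣ℓ∣ α ℕ.+ s)           ≡⟨ cong₂ _+ℤ_ (ℓ-⊕ α (vsum H)) (ℤ.pos-+ (∣ℓ∣ α) s) ⟩
    (ℓ α +ℤ ℓ (vsum H)) +ℤ (+ ∣ℓ∣ α +ℤ + s)     ≡⟨ interchange (ℓ α) _ _ _ ⟩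
    (ℓ α +ℤ + ∣ℓ∣ α) +ℤ (ℓ (vsum H) +ℤ + s)     ∎
    where open ≡-Reasoning

E7-unique : Unique E7
E7-unique = toWitness {a? = unique? _≟ᵥ_ E7} _

E7-negClosed : NegClosed E7
E7-negClosed = toWitness {a? = negClosed? E7} _

E7-4∣ℓ+∣ℓ∣ : All (λ α → + 4 ∣ ℓ α +ℤ + ∣ℓ∣ α) E7
E7-4∣ℓ+∣ℓ∣ = toWitness {a? = all? (λ α → + 4 ∣? ℓ α +ℤ + ∣ℓ∣ α) E7} _

E7-sum∣ℓ∣ : sum (map ∣ℓ∣ E7) ≡ 108
E7-sum∣ℓ∣ = refl

E7-half-sum∣ℓ∣ : ∀ {H} → IsHalf E7 H → sum (map ∣ℓ∣ H) ≡ 54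
E7-half-sum∣ℓ∣ H-half = ℕ.*-cancelˡ-≡ _ 54 2
  (trans (sum-half ∣ℓ∣ ∣ℓ∣-neg E7-unique E7-negClosed H-half) E7-sum∣ℓ∣)

E7-noZeroSumHalf : ¬ HasZeroSumHalf E7
E7-noZeroSumHalf (H , H-half , H-sum) = toWitnessFalse {a? = + 4 ∣? + 54} _ 4∣54
  where
  4∣54 : + 4 ∣ + 54
  4∣54 = subst₂ (λ v s → + 4 ∣ ℓ v +ℤ + s) H-sum (E7-half-sum∣ℓ∣ H-half)
    (∣ℓ[vsum]+sum∣ℓ∣ H (anti-mono (λ {α} → proj₁ (proj₂ H-half) α) E7-4∣ℓ+∣ℓ∣))

p2 p1 z0 m1 m2 : ℤ
p2 = + 2
p1 = + 1
z0 = + 0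
m1 = -[1+ 0 ]
m2 = -[1+ 1 ]

H6 : List (Vec ℤ 6)
H6 =
  (p2 ∷ p2 ∷ z0 ∷ z0 ∷ z0 ∷ z0 ∷ []) List.∷
  (p2 ∷ m2 ∷ z0 ∷ z0 ∷ z0 ∷ z0 ∷ []) List.∷
  (m2 ∷ z0 ∷ m2 ∷ z0 ∷ z0 ∷ z0 ∷ []) List.∷
  (p2 ∷ z0 ∷ m2 ∷ z0 ∷ z0 ∷ z0 ∷ []) List.∷
  (m2 ∷ z0 ∷ z0 ∷ m2 ∷ z0 ∷ z0 ∷ []) List.∷
  (m2 ∷ z0 ∷ z0 ∷ p2 ∷ z0 ∷ z0 ∷ []) List.∷
  (m2 ∷ z0 ∷ z0 ∷ z0 ∷ m2 ∷ z0 ∷ []) List.∷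
  (m2 ∷ z0 ∷ z0 ∷ z0 ∷ p2 ∷ z0 ∷ []) List.∷
  (z0 ∷ p2 ∷ p2 ∷ z0 ∷ z0 ∷ z0 ∷ []) List.∷
  (z0 ∷ p2 ∷ m2 ∷ z0 ∷ z0 ∷ z0 ∷ []) List.∷
  (z0 ∷ p2 ∷ z0 ∷ p2 ∷ z0 ∷ z0 ∷ []) List.∷
  (z0 ∷ m2 ∷ z0 ∷ p2 ∷ z0 ∷ z0 ∷ []) List.∷
  (z0 ∷ m2 ∷ z0 ∷ z0 ∷ m2 ∷ z0 ∷ []) List.∷
  (z0 ∷ m2 ∷ z0 ∷ z0 ∷ p2 ∷ z0 ∷ []) List.∷
  (z0 ∷ z0 ∷ p2 ∷ p2 ∷ z0 ∷ z0 ∷ []) List.∷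
  (z0 ∷ z0 ∷ m2 ∷ p2 ∷ z0 ∷ z0 ∷ []) List.∷
  (z0 ∷ z0 ∷ m2 ∷ z0 ∷ m2 ∷ z0 ∷ []) List.∷
  (z0 ∷ z0 ∷ p2 ∷ z0 ∷ m2 ∷ z0 ∷ []) List.∷
  (z0 ∷ z0 ∷ z0 ∷ m2 ∷ m2 ∷ z0 ∷ []) List.∷
  (z0 ∷ z0 ∷ z0 ∷ m2 ∷ p2 ∷ z0 ∷ []) List.∷
  (p1 ∷ p1 ∷ p1 ∷ p1 ∷ p1 ∷ m1 ∷ []) List.∷
  (m1 ∷ m1 ∷ m1 ∷ m1 ∷ p1 ∷ m1 ∷ []) List.∷
  (p1 ∷ p1 ∷ p1 ∷ m1 ∷ p1 ∷ p1 ∷ []) List.∷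
  (p1 ∷ p1 ∷ p1 ∷ m1 ∷ m1 ∷ m1 ∷ []) List.∷
  (m1 ∷ m1 ∷ p1 ∷ m1 ∷ m1 ∷ m1 ∷ []) List.∷
  (p1 ∷ p1 ∷ m1 ∷ p1 ∷ m1 ∷ m1 ∷ []) List.∷
  (p1 ∷ p1 ∷ m1 ∷ m1 ∷ p1 ∷ m1 ∷ []) List.∷
  (m1 ∷ m1 ∷ p1 ∷ p1 ∷ p1 ∷ m1 ∷ []) List.∷
  (p1 ∷ m1 ∷ p1 ∷ p1 ∷ p1 ∷ p1 ∷ []) List.∷
  (m1 ∷ p1 ∷ m1 ∷ m1 ∷ p1 ∷ p1 ∷ []) List.∷
  (p1 ∷ m1 ∷ p1 ∷ m1 ∷ p1 ∷ m1 ∷ []) List.∷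
  (p1 ∷ m1 ∷ p1 ∷ m1 ∷ m1 ∷ p1 ∷ []) List.∷
  (m1 ∷ p1 ∷ p1 ∷ m1 ∷ m1 ∷ p1 ∷ []) List.∷
  (p1 ∷ m1 ∷ m1 ∷ p1 ∷ m1 ∷ p1 ∷ []) List.∷
  (p1 ∷ m1 ∷ m1 ∷ m1 ∷ p1 ∷ p1 ∷ []) List.∷
  (m1 ∷ p1 ∷ p1 ∷ p1 ∷ p1 ∷ p1 ∷ []) List.∷
  List.[]

H8 : List (Vec ℤ 8)
H8 =
  (m2 ∷ m2 ∷ z0 ∷ z0 ∷ z0 ∷ z0 ∷ z0 ∷ z0 ∷ []) List.∷
  (p2 ∷ m2 ∷ z0 ∷ z0 ∷ z0 ∷ z0 ∷ z0 ∷ z0 ∷ []) List.∷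
  (p2 ∷ z0 ∷ p2 ∷ z0 ∷ z0 ∷ z0 ∷ z0 ∷ z0 ∷ []) List.∷
  (p2 ∷ z0 ∷ m2 ∷ z0 ∷ z0 ∷ z0 ∷ z0 ∷ z0 ∷ []) List.∷
  (p2 ∷ z0 ∷ z0 ∷ p2 ∷ z0 ∷ z0 ∷ z0 ∷ z0 ∷ []) List.∷
  (m2 ∷ z0 ∷ z0 ∷ p2 ∷ z0 ∷ z0 ∷ z0 ∷ z0 ∷ []) List.∷
  (m2 ∷ z0 ∷ z0 ∷ z0 ∷ m2 ∷ z0 ∷ z0 ∷ z0 ∷ []) List.∷
  (m2 ∷ z0 ∷ z0 ∷ z0 ∷ p2 ∷ z0 ∷ z0 ∷ z0 ∷ []) List.∷
  (m2 ∷ z0 ∷ z0 ∷ z0 ∷ z0 ∷ m2 ∷ z0 ∷ z0 ∷ []) List.∷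
  (m2 ∷ z0 ∷ z0 ∷ z0 ∷ z0 ∷ p2 ∷ z0 ∷ z0 ∷ []) List.∷
  (m2 ∷ z0 ∷ z0 ∷ z0 ∷ z0 ∷ z0 ∷ m2 ∷ z0 ∷ []) List.∷
  (p2 ∷ z0 ∷ z0 ∷ z0 ∷ z0 ∷ z0 ∷ m2 ∷ z0 ∷ []) List.∷
  (m2 ∷ z0 ∷ z0 ∷ z0 ∷ z0 ∷ z0 ∷ z0 ∷ m2 ∷ []) List.∷
  (p2 ∷ z0 ∷ z0 ∷ z0 ∷ z0 ∷ z0 ∷ z0 ∷ m2 ∷ []) List.∷
  (z0 ∷ m2 ∷ m2 ∷ z0 ∷ z0 ∷ z0 ∷ z0 ∷ z0 ∷ []) List.∷
  (z0 ∷ m2 ∷ p2 ∷ z0 ∷ z0 ∷ z0 ∷ z0 ∷ z0 ∷ []) List.∷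
  (z0 ∷ m2 ∷ z0 ∷ m2 ∷ z0 ∷ z0 ∷ z0 ∷ z0 ∷ []) List.∷
  (z0 ∷ p2 ∷ z0 ∷ m2 ∷ z0 ∷ z0 ∷ z0 ∷ z0 ∷ []) List.∷
  (z0 ∷ m2 ∷ z0 ∷ z0 ∷ m2 ∷ z0 ∷ z0 ∷ z0 ∷ []) List.∷
  (z0 ∷ m2 ∷ z0 ∷ z0 ∷ p2 ∷ z0 ∷ z0 ∷ z0 ∷ []) List.∷
  (z0 ∷ m2 ∷ z0 ∷ z0 ∷ z0 ∷ m2 ∷ z0 ∷ z0 ∷ []) List.∷
  (z0 ∷ p2 ∷ z0 ∷ z0 ∷ z0 ∷ m2 ∷ z0 ∷ z0 ∷ []) List.∷
  (z0 ∷ p2 ∷ z0 ∷ z0 ∷ z0 ∷ z0 ∷ p2 ∷ z0 ∷ []) List.∷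
  (z0 ∷ p2 ∷ z0 ∷ z0 ∷ z0 ∷ z0 ∷ m2 ∷ z0 ∷ []) List.∷
  (z0 ∷ p2 ∷ z0 ∷ z0 ∷ z0 ∷ z0 ∷ z0 ∷ p2 ∷ []) List.∷
  (z0 ∷ p2 ∷ z0 ∷ z0 ∷ z0 ∷ z0 ∷ z0 ∷ m2 ∷ []) List.∷
  (z0 ∷ z0 ∷ p2 ∷ p2 ∷ z0 ∷ z0 ∷ z0 ∷ z0 ∷ []) List.∷
  (z0 ∷ z0 ∷ p2 ∷ m2 ∷ z0 ∷ z0 ∷ z0 ∷ z0 ∷ []) List.∷
  (z0 ∷ z0 ∷ m2 ∷ z0 ∷ m2 ∷ z0 ∷ z0 ∷ z0 ∷ []) List.∷
  (z0 ∷ z0 ∷ m2 ∷ z0 ∷ p2 ∷ z0 ∷ z0 ∷ z0 ∷ []) List.∷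
  (z0 ∷ z0 ∷ m2 ∷ z0 ∷ z0 ∷ m2 ∷ z0 ∷ z0 ∷ []) List.∷
  (z0 ∷ z0 ∷ p2 ∷ z0 ∷ z0 ∷ m2 ∷ z0 ∷ z0 ∷ []) List.∷
  (z0 ∷ z0 ∷ p2 ∷ z0 ∷ z0 ∷ z0 ∷ p2 ∷ z0 ∷ []) List.∷
  (z0 ∷ z0 ∷ m2 ∷ z0 ∷ z0 ∷ z0 ∷ p2 ∷ z0 ∷ []) List.∷
  (z0 ∷ z0 ∷ p2 ∷ z0 ∷ z0 ∷ z0 ∷ z0 ∷ p2 ∷ []) List.∷
  (z0 ∷ z0 ∷ m2 ∷ z0 ∷ z0 ∷ z0 ∷ z0 ∷ p2 ∷ []) List.∷
  (z0 ∷ z0 ∷ z0 ∷ m2 ∷ m2 ∷ z0 ∷ z0 ∷ z0 ∷ []) List.∷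
  (z0 ∷ z0 ∷ z0 ∷ m2 ∷ p2 ∷ z0 ∷ z0 ∷ z0 ∷ []) List.∷
  (z0 ∷ z0 ∷ z0 ∷ m2 ∷ z0 ∷ m2 ∷ z0 ∷ z0 ∷ []) List.∷
  (z0 ∷ z0 ∷ z0 ∷ p2 ∷ z0 ∷ m2 ∷ z0 ∷ z0 ∷ []) List.∷
  (z0 ∷ z0 ∷ z0 ∷ m2 ∷ z0 ∷ z0 ∷ m2 ∷ z0 ∷ []) List.∷
  (z0 ∷ z0 ∷ z0 ∷ m2 ∷ z0 ∷ z0 ∷ p2 ∷ z0 ∷ []) List.∷
  (z0 ∷ z0 ∷ z0 ∷ p2 ∷ z0 ∷ z0 ∷ z0 ∷ p2 ∷ []) List.∷
  (z0 ∷ z0 ∷ z0 ∷ p2 ∷ z0 ∷ z0 ∷ z0 ∷ m2 ∷ []) List.∷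
  (z0 ∷ z0 ∷ z0 ∷ z0 ∷ m2 ∷ m2 ∷ z0 ∷ z0 ∷ []) List.∷
  (z0 ∷ z0 ∷ z0 ∷ z0 ∷ p2 ∷ m2 ∷ z0 ∷ z0 ∷ []) List.∷
  (z0 ∷ z0 ∷ z0 ∷ z0 ∷ p2 ∷ z0 ∷ p2 ∷ z0 ∷ []) List.∷
  (z0 ∷ z0 ∷ z0 ∷ z0 ∷ m2 ∷ z0 ∷ p2 ∷ z0 ∷ []) List.∷
  (z0 ∷ z0 ∷ z0 ∷ z0 ∷ m2 ∷ z0 ∷ z0 ∷ m2 ∷ []) List.∷
  (z0 ∷ z0 ∷ z0 ∷ z0 ∷ p2 ∷ z0 ∷ z0 ∷ m2 ∷ []) List.∷
  (z0 ∷ z0 ∷ z0 ∷ z0 ∷ z0 ∷ m2 ∷ m2 ∷ z0 ∷ []) List.∷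
  (z0 ∷ z0 ∷ z0 ∷ z0 ∷ z0 ∷ p2 ∷ m2 ∷ z0 ∷ []) List.∷
  (z0 ∷ z0 ∷ z0 ∷ z0 ∷ z0 ∷ p2 ∷ z0 ∷ p2 ∷ []) List.∷
  (z0 ∷ z0 ∷ z0 ∷ z0 ∷ z0 ∷ p2 ∷ z0 ∷ m2 ∷ []) List.∷
  (z0 ∷ z0 ∷ z0 ∷ z0 ∷ z0 ∷ z0 ∷ p2 ∷ p2 ∷ []) List.∷
  (z0 ∷ z0 ∷ z0 ∷ z0 ∷ z0 ∷ z0 ∷ p2 ∷ m2 ∷ []) List.∷
  (p1 ∷ p1 ∷ p1 ∷ p1 ∷ p1 ∷ p1 ∷ p1 ∷ p1 ∷ []) List.∷
  (p1 ∷ p1 ∷ p1 ∷ p1 ∷ p1 ∷ p1 ∷ m1 ∷ m1 ∷ []) List.∷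
  (m1 ∷ m1 ∷ m1 ∷ m1 ∷ m1 ∷ p1 ∷ m1 ∷ p1 ∷ []) List.∷
  (m1 ∷ m1 ∷ m1 ∷ m1 ∷ m1 ∷ p1 ∷ p1 ∷ m1 ∷ []) List.∷
  (p1 ∷ p1 ∷ p1 ∷ p1 ∷ m1 ∷ p1 ∷ p1 ∷ m1 ∷ []) List.∷
  (p1 ∷ p1 ∷ p1 ∷ p1 ∷ m1 ∷ p1 ∷ m1 ∷ p1 ∷ []) List.∷
  (p1 ∷ p1 ∷ p1 ∷ p1 ∷ m1 ∷ m1 ∷ p1 ∷ p1 ∷ []) List.∷
  (p1 ∷ p1 ∷ p1 ∷ p1 ∷ m1 ∷ m1 ∷ m1 ∷ m1 ∷ []) List.∷
  (p1 ∷ p1 ∷ p1 ∷ m1 ∷ p1 ∷ p1 ∷ p1 ∷ m1 ∷ []) List.∷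
  (p1 ∷ p1 ∷ p1 ∷ m1 ∷ p1 ∷ p1 ∷ m1 ∷ p1 ∷ []) List.∷
  (m1 ∷ m1 ∷ m1 ∷ p1 ∷ m1 ∷ p1 ∷ m1 ∷ m1 ∷ []) List.∷
  (m1 ∷ m1 ∷ m1 ∷ p1 ∷ m1 ∷ p1 ∷ p1 ∷ p1 ∷ []) List.∷
  (p1 ∷ p1 ∷ p1 ∷ m1 ∷ m1 ∷ p1 ∷ p1 ∷ p1 ∷ []) List.∷
  (m1 ∷ m1 ∷ m1 ∷ p1 ∷ p1 ∷ m1 ∷ p1 ∷ p1 ∷ []) List.∷
  (p1 ∷ p1 ∷ p1 ∷ m1 ∷ m1 ∷ m1 ∷ p1 ∷ m1 ∷ []) List.∷
  (p1 ∷ p1 ∷ p1 ∷ m1 ∷ m1 ∷ m1 ∷ m1 ∷ p1 ∷ []) List.∷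
  (m1 ∷ m1 ∷ p1 ∷ m1 ∷ m1 ∷ m1 ∷ m1 ∷ p1 ∷ []) List.∷
  (m1 ∷ m1 ∷ p1 ∷ m1 ∷ m1 ∷ m1 ∷ p1 ∷ m1 ∷ []) List.∷
  (p1 ∷ p1 ∷ m1 ∷ p1 ∷ p1 ∷ m1 ∷ p1 ∷ p1 ∷ []) List.∷
  (m1 ∷ m1 ∷ p1 ∷ m1 ∷ m1 ∷ p1 ∷ p1 ∷ p1 ∷ []) List.∷
  (m1 ∷ m1 ∷ p1 ∷ m1 ∷ p1 ∷ m1 ∷ m1 ∷ m1 ∷ []) List.∷
  (m1 ∷ m1 ∷ p1 ∷ m1 ∷ p1 ∷ m1 ∷ p1 ∷ p1 ∷ []) List.∷
  (p1 ∷ p1 ∷ m1 ∷ p1 ∷ m1 ∷ m1 ∷ p1 ∷ m1 ∷ []) List.∷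
  (p1 ∷ p1 ∷ m1 ∷ p1 ∷ m1 ∷ m1 ∷ m1 ∷ p1 ∷ []) List.∷
  (p1 ∷ p1 ∷ m1 ∷ m1 ∷ p1 ∷ p1 ∷ p1 ∷ p1 ∷ []) List.∷
  (p1 ∷ p1 ∷ m1 ∷ m1 ∷ p1 ∷ p1 ∷ m1 ∷ m1 ∷ []) List.∷
  (p1 ∷ p1 ∷ m1 ∷ m1 ∷ p1 ∷ m1 ∷ p1 ∷ m1 ∷ []) List.∷
  (m1 ∷ m1 ∷ p1 ∷ p1 ∷ m1 ∷ p1 ∷ p1 ∷ m1 ∷ []) List.∷
  (m1 ∷ m1 ∷ p1 ∷ p1 ∷ p1 ∷ m1 ∷ m1 ∷ p1 ∷ []) List.∷
  (p1 ∷ p1 ∷ m1 ∷ m1 ∷ m1 ∷ p1 ∷ m1 ∷ p1 ∷ []) List.∷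
  (m1 ∷ m1 ∷ p1 ∷ p1 ∷ p1 ∷ p1 ∷ m1 ∷ m1 ∷ []) List.∷
  (m1 ∷ m1 ∷ p1 ∷ p1 ∷ p1 ∷ p1 ∷ p1 ∷ p1 ∷ []) List.∷
  (m1 ∷ p1 ∷ m1 ∷ m1 ∷ m1 ∷ m1 ∷ m1 ∷ p1 ∷ []) List.∷
  (p1 ∷ m1 ∷ p1 ∷ p1 ∷ p1 ∷ p1 ∷ m1 ∷ p1 ∷ []) List.∷
  (m1 ∷ p1 ∷ m1 ∷ m1 ∷ m1 ∷ p1 ∷ m1 ∷ m1 ∷ []) List.∷
  (p1 ∷ m1 ∷ p1 ∷ p1 ∷ p1 ∷ m1 ∷ m1 ∷ m1 ∷ []) List.∷
  (p1 ∷ m1 ∷ p1 ∷ p1 ∷ m1 ∷ p1 ∷ p1 ∷ p1 ∷ []) List.∷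
  (p1 ∷ m1 ∷ p1 ∷ p1 ∷ m1 ∷ p1 ∷ m1 ∷ m1 ∷ []) List.∷
  (m1 ∷ p1 ∷ m1 ∷ m1 ∷ p1 ∷ p1 ∷ m1 ∷ p1 ∷ []) List.∷
  (m1 ∷ p1 ∷ m1 ∷ m1 ∷ p1 ∷ p1 ∷ p1 ∷ m1 ∷ []) List.∷
  (m1 ∷ p1 ∷ m1 ∷ p1 ∷ m1 ∷ m1 ∷ m1 ∷ m1 ∷ []) List.∷
  (p1 ∷ m1 ∷ p1 ∷ m1 ∷ p1 ∷ p1 ∷ m1 ∷ m1 ∷ []) List.∷
  (p1 ∷ m1 ∷ p1 ∷ m1 ∷ p1 ∷ m1 ∷ p1 ∷ m1 ∷ []) List.∷
  (m1 ∷ p1 ∷ m1 ∷ p1 ∷ m1 ∷ p1 ∷ p1 ∷ m1 ∷ []) List.∷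
  (m1 ∷ p1 ∷ m1 ∷ p1 ∷ p1 ∷ m1 ∷ m1 ∷ p1 ∷ []) List.∷
  (m1 ∷ p1 ∷ m1 ∷ p1 ∷ p1 ∷ m1 ∷ p1 ∷ m1 ∷ []) List.∷
  (m1 ∷ p1 ∷ m1 ∷ p1 ∷ p1 ∷ p1 ∷ m1 ∷ m1 ∷ []) List.∷
  (m1 ∷ p1 ∷ m1 ∷ p1 ∷ p1 ∷ p1 ∷ p1 ∷ p1 ∷ []) List.∷
  (p1 ∷ m1 ∷ m1 ∷ p1 ∷ p1 ∷ p1 ∷ p1 ∷ p1 ∷ []) List.∷
  (m1 ∷ p1 ∷ p1 ∷ m1 ∷ m1 ∷ m1 ∷ p1 ∷ p1 ∷ []) List.∷
  (m1 ∷ p1 ∷ p1 ∷ m1 ∷ m1 ∷ p1 ∷ m1 ∷ p1 ∷ []) List.∷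
  (p1 ∷ m1 ∷ m1 ∷ p1 ∷ p1 ∷ m1 ∷ m1 ∷ p1 ∷ []) List.∷
  (p1 ∷ m1 ∷ m1 ∷ p1 ∷ m1 ∷ p1 ∷ p1 ∷ m1 ∷ []) List.∷
  (p1 ∷ m1 ∷ m1 ∷ p1 ∷ m1 ∷ p1 ∷ m1 ∷ p1 ∷ []) List.∷
  (p1 ∷ m1 ∷ m1 ∷ p1 ∷ m1 ∷ m1 ∷ p1 ∷ p1 ∷ []) List.∷
  (m1 ∷ p1 ∷ p1 ∷ m1 ∷ p1 ∷ p1 ∷ p1 ∷ p1 ∷ []) List.∷
  (p1 ∷ m1 ∷ m1 ∷ m1 ∷ p1 ∷ p1 ∷ p1 ∷ m1 ∷ []) List.∷
  (p1 ∷ m1 ∷ m1 ∷ m1 ∷ p1 ∷ p1 ∷ m1 ∷ p1 ∷ []) List.∷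
  (m1 ∷ p1 ∷ p1 ∷ p1 ∷ m1 ∷ p1 ∷ m1 ∷ m1 ∷ []) List.∷
  (p1 ∷ m1 ∷ m1 ∷ m1 ∷ p1 ∷ m1 ∷ m1 ∷ m1 ∷ []) List.∷
  (m1 ∷ p1 ∷ p1 ∷ p1 ∷ p1 ∷ m1 ∷ m1 ∷ m1 ∷ []) List.∷
  (p1 ∷ m1 ∷ m1 ∷ m1 ∷ m1 ∷ p1 ∷ m1 ∷ m1 ∷ []) List.∷
  (m1 ∷ p1 ∷ p1 ∷ p1 ∷ p1 ∷ p1 ∷ m1 ∷ p1 ∷ []) List.∷
  (p1 ∷ m1 ∷ m1 ∷ m1 ∷ m1 ∷ m1 ∷ m1 ∷ p1 ∷ []) List.∷
  List.[]

proposition2p3 : HasZeroSumHalf E6 × HasZeroSumHalf E8 × ¬ HasZeroSumHalf E7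
proposition2p3 = zeroSumHalf E6 H6 refl , zeroSumHalf E8 H8 refl , E7-noZeroSumHalf
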